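{- Let $S$ be a minimal zero-sum sequence over $\mathbb{Z}$ with finitely many terms and $|S|>1$. Write $S=S^+\cdot S^-$, where \[S^+=\prod_{i=1}^n a_i^{[x_i]},\qquad S^-=\prod_{j=1}^m (-b_j)^{[y_j]},\] with positive integers $a_1\le\cdots\le a_n$, $b_1\le\cdots\le b_m$ and positive integer multiplicities $x_i$, $y_j$ (such a representation exists for every such $S$). Then \[|S^+|=\sum_{i=1}^n x_i\le \left\lfloor \frac{\sum_{j=1}^m b_j y_j}{\sum_{j=1}^m y_j}\right\rfloor \quad\text{and}\quad |S^-|=\sum_{j=1}^m y_j\le \left\lfloor \frac{\sum_{i=1}^n a_i x_i}{\sum_{i=1}^n x_i}\right\rfloor.\] Equivalently, $|S^+|\le \lfloor -S^-_{\rm av}\rfloor$ and $|S^-|\le \lfloor S^+_{\rm av}\rfloor$.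
   Context: A sequence over a subset $G_0$ of an abelian group is an unordered finite list of elements of $G_0$ (an element of the free abelian monoid on $G_0$), with concatenation written as a product $R\cdot T$; $R$ and $T$ are then called subsequences of $R\cdot T$. For $g\in G_0$ and an integer $d\ge 0$, $g^{[d]}$ denotes the sequence consisting of $d$ copies of $g$. For a sequence $S=s_1\cdot\ldots\cdot s_t$: its length is $|S|=t$, its sum is $\sigma(S)=s_1+\cdots+s_t$, and its average is $S_{\rm av}=\sigma(S)/|S|$. A zero-sum sequence is one with $\sigma(S)=0$; it is minimal if it is nonempty and has no proper nontrivial (nonempty) zero-sum subsequence. $S^+$ denotes the subsequence of positive terms of $S$ and $S^-$ the subsequence of negative terms. -}

module Defs where

open import Data.Nat using (ℕ; zero; suc; _*_; _<_)
open import Data.Nat.DivMod using (_/_)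
open import Data.Integer using (ℤ; +_; -_)
import Data.Integer
open import Data.Fin using (Fin)
open import Data.List using (List; []; _∷_; length; tabulate; concat; replicate; map; foldr)
open import Data.Nat.ListAction using (sum)
open import Data.List.Relation.Binary.Sublist.Propositional using (_⊆_)
open import Data.Product using (_×_)
open import Relation.Binary.PropositionalEquality using (_≡_; _≢_)
open import Relation.Nullary using (¬_)

-- A sequence over ℤ is a finite list of integers (considered up to
-- permutation). σ(S) is the sum of its terms.
σ : List ℤ → ℤ
σ = foldr Data.Integer._+_ (+ 0)

-- A (sub-multiset) subsequence T of S is realised (up to order) as a
-- sublist of S, i.e. a choice of positions of S.
MinimalZeroSum : List ℤ → Set
MinimalZeroSum S =
  (S ≢ []) × (σ S ≡ + 0) ×
  (∀ (T : List ℤ) → T ⊆ S → T ≢ [] → length T < length S → ¬ (σ T ≡ + 0))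

Σℕ : (n : ℕ) → (Fin n → ℕ) → ℕ
Σℕ n f = sum (tabulate f)

block : (n : ℕ) → (Fin n → ℤ) → (Fin n → ℕ) → List ℤ
block n a x = concat (tabulate (λ i → replicate (x i) (a i)))

-- floor division on ℕ (⌊a / c⌋ for c ≥ 1; the value for c = 0 is irrelevant)
⌊_/_⌋ : ℕ → ℕ → ℕ
⌊ a / zero ⌋ = 0
⌊ a / suc c ⌋ = a / suc c

-- Write S⁺ = P and S⁻ = −N with P, N lists of positive integers of common sum A, and let
-- u_i (i < |P|) and v_j (j < |N|) be their proper prefix sums, all in [0, A). The |P|·|N|
-- residues u_i − v_j mod A are pairwise distinct: a coincidence makes a proper nonempty
-- slice of P have the sum of a slice of N or of the complement of one, which yields a proper
-- zero-sum subsequence of S. Hence |P|·|N| ≤ A, and dividing by |N| resp. |P| gives both bounds.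

module Submission where

open import Defs
open import Data.Nat
  using (ℕ; zero; suc; _+_; _*_; _∸_; _≤_; _<_; _⊓_; z≤n; s≤s; _≤?_)
open import Data.Nat.Properties
open import Data.Nat.DivMod using (_/_; m*n/n≡m; /-monoˡ-≤)
open import Data.Nat.ListAction using (sum)
open import Data.Nat.ListAction.Properties using (sum-++)
open import Algebra.Properties.CommutativeSemigroup +-commutativeSemigroup using (xy∙z≈xz∙y; x∙yz≈xz∙y)
open import Data.Integer as ℤ using (ℤ; +_; -_)
import Data.Integer.Properties as ℤ
open import Data.Fin as Fin using (Fin; toℕ; fromℕ<; combine; remQuot) renaming (_≤_ to _≤ᶠ_)
open import Data.Fin.Properties using (toℕ-fromℕ<; toℕ-injective; toℕ<n; injective⇒≤; combine-remQuot)
open import Data.List using (List; []; _∷_; length; take; drop; _++_; map; concat; tabulate; replicate)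
open import Data.List.Properties
  using (take++drop≡id; take-all; length-take; length-drop; length-++; length-map; length-replicate;
         map-replicate; map-tabulate; tabulate-cong; concat-map)
open import Data.List.Relation.Unary.All using (All; []; _∷_)
open import Data.List.Relation.Unary.All.Properties using (concat⁺; tabulate⁺; replicate⁺; take⁺; drop⁺)
open import Data.List.Relation.Binary.Sublist.Propositional using (_⊆_; []; _∷_; _∷ʳ_; ⊆-refl; ⊆-trans)
open import Data.List.Relation.Binary.Sublist.Propositional.Properties
  using (take-⊆; drop-⊆; drop⁺-≥; ++⁺; map⁺; length-mono-≤)
open import Data.List.Relation.Binary.Permutation.Propositional
  using (_↭_; refl; prep; swap; trans; ↭-sym; ↭⇒↭ₛ)
open import Data.List.Relation.Binary.Permutation.Propositional.Properties using (↭-length)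
open import Data.List.Relation.Binary.Permutation.Setoid.Properties using (foldr-commMonoid)
open import Data.Product using (Σ; _×_; _,_; proj₁; proj₂; uncurry)
open import Data.Product.Properties using (×-≡,≡→≡)
open import Data.Sum using (_⊎_; inj₁; inj₂)
open import Data.Empty using (⊥; ⊥-elim)
open import Function using (_∘_)
open import Algebra.Bundles using (CommutativeMonoid)
open import Relation.Binary using (tri<; tri≈; tri>; _Preserves_⟶_)
open import Relation.Binary.PropositionalEquality
  using (_≡_; _≢_; refl; sym; cong; cong₂; subst; module ≡-Reasoning)
  renaming (trans to ≡-trans)
open import Relation.Nullary using (yes; no)

Positive : List ℕ → Set
Positive = All (1 ≤_)

length≤sum : ∀ {L} → Positive L → length L ≤ sum L
length≤sum []         = z≤n
length≤sum (1≤x ∷ L⁺) = +-mono-≤ 1≤x (length≤sum L⁺)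

prefixSum : List ℕ → ℕ → ℕ
prefixSum L i = sum (take i L)

slice : ℕ → ℕ → List ℕ → List ℕ
slice k i L = drop k (take i L)

prefixSum-slice : ∀ L {k i} → k ≤ i → prefixSum L i ≡ prefixSum L k + sum (slice k i L)
prefixSum-slice L       {zero}  _       = refl
prefixSum-slice []      {suc k} (s≤s _) = refl
prefixSum-slice (x ∷ L) {suc k} (s≤s k≤i) =
  ≡-trans (cong (_+_ x) (prefixSum-slice L k≤i)) (sym (+-assoc x _ _))

sum≡prefixSum+sum-drop : ∀ L l → sum L ≡ prefixSum L l + sum (drop l L)
sum≡prefixSum+sum-drop L l =
  ≡-trans (cong sum (sym (take++drop≡id l L))) (sum-++ (take l L) (drop l L))

length-slice : ∀ L k {i} → i ≤ length L → length (slice k i L) ≡ i ∸ k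
length-slice L k {i} i≤∣L∣ = begin
  length (drop k (take i L))  ≡⟨ length-drop k (take i L) ⟩
  length (take i L) ∸ k       ≡⟨ cong (_∸ k) (length-take i L) ⟩
  (i ⊓ length L) ∸ k          ≡⟨ cong (_∸ k) (m≤n⇒m⊓n≡m i≤∣L∣) ⟩
  i ∸ k                       ∎
  where open ≡-Reasoning

slice-⊆ : ∀ k i L → slice k i L ⊆ L
slice-⊆ k i L = ⊆-trans (drop-⊆ k (take i L)) (take-⊆ i L)

take++drop-⊆ : ∀ {A : Set} {j l} (L : List A) → j ≤ l → take j L ++ drop l L ⊆ L
take++drop-⊆ {j = j} {l} L j≤l =
  subst (take j L ++ drop l L ⊆_) (take++drop≡id j L) (++⁺ ⊆-refl (drop⁺-≥ j≤l))

slice-sum-positive : ∀ {L k i} → Positive L → k < i → i ≤ length L → 1 ≤ sum (slice k i L)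
slice-sum-positive {L} {k} {i} L⁺ k<i i≤∣L∣ = begin
  1                        ≤⟨ m<n⇒0<n∸m k<i ⟩
  i ∸ k                    ≡⟨ length-slice L k i≤∣L∣ ⟨
  length (slice k i L)     ≤⟨ length≤sum (drop⁺ k (take⁺ i L⁺)) ⟩
  sum (slice k i L)        ∎
  where open ≤-Reasoning

prefixSum-mono : ∀ L {k i} → k ≤ i → prefixSum L k ≤ prefixSum L i
prefixSum-mono L {k} k≤i = subst (prefixSum L k ≤_) (sym (prefixSum-slice L k≤i)) (m≤m+n _ _)

prefixSum-strictMono : ∀ {L} → Positive L → ∀ {k i} → k < i → i ≤ length L →
                       prefixSum L k < prefixSum L i
prefixSum-strictMono {L} L⁺ {k} k<i i≤∣L∣ =
  subst (prefixSum L k <_) (sym (prefixSum-slice L (<⇒≤ k<i)))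
        (m<m+n _ (slice-sum-positive L⁺ k<i i≤∣L∣))

prefixSum<sum : ∀ {L} → Positive L → ∀ {i} → i < length L → prefixSum L i < sum L
prefixSum<sum {L} L⁺ {i} i<∣L∣ =
  subst (prefixSum L i <_) (cong sum (take-all (length L) L ≤-refl))
        (prefixSum-strictMono L⁺ i<∣L∣ ≤-refl)

prefixSum-injective : ∀ {L} → Positive L → ∀ {j l} → j < length L → l < length L →
                      prefixSum L j ≡ prefixSum L l → j ≡ l
prefixSum-injective L⁺ {j} {l} j<∣L∣ l<∣L∣ e with <-cmp j l
... | tri≈ _ j≡l _ = j≡l
... | tri< j<l _ _ = ⊥-elim (<-irrefl e (prefixSum-strictMono L⁺ j<l (<⇒≤ l<∣L∣)))
... | tri> _ _ l<j = ⊥-elim (<-irrefl (sym e) (prefixSum-strictMono L⁺ l<j (<⇒≤ j<∣L∣)))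

diffMod : ℕ → ℕ → ℕ → ℕ
diffMod A u v with v ≤? u
... | yes _ = u ∸ v
... | no  _ = u + A ∸ v

diffMod+v≡u⊎u+A : ∀ A u v → v < A → (diffMod A u v + v ≡ u) ⊎ (diffMod A u v + v ≡ u + A)
diffMod+v≡u⊎u+A A u v v<A with v ≤? u
... | yes v≤u = inj₁ (m∸n+n≡m v≤u)
... | no  _   = inj₂ (m∸n+n≡m (≤-trans (<⇒≤ v<A) (m≤n+m A u)))

diffMod<A : ∀ A u v → u < A → v < A → diffMod A u v < A
diffMod<A A u v u<A v<A with v ≤? u
... | yes _   = ≤-<-trans (m∸n≤m u v) u<A
... | no  v≰u = begin-strict
  u + A ∸ v  <⟨ ∸-monoˡ-< (+-monoˡ-< A (≰⇒> v≰u)) (≤-trans (<⇒≤ v<A) (m≤n+m A u)) ⟩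
  v + A ∸ v  ≡⟨ m+n∸m≡n v A ⟩
  A          ∎
  where open ≤-Reasoning

+-exchange : ∀ {w w′ v v′ X Y} → w ≡ w′ → w + v ≡ X → w′ + v′ ≡ Y → X + v′ ≡ Y + v
+-exchange {w} {v = v} {v′} {X} {Y} refl e e′ = begin
  X + v′      ≡⟨ cong (_+ v′) e ⟨
  w + v + v′  ≡⟨ xy∙z≈xz∙y w v v′ ⟩
  w + v′ + v  ≡⟨ cong (_+ v) e′ ⟩
  Y + v       ∎
  where open ≡-Reasoning

diffMod-≡⇒ : ∀ A u v u′ v′ → v < A → v′ < A → diffMod A u v ≡ diffMod A u′ v′ →
             (u + v′ ≡ u′ + v) ⊎ (u + v′ ≡ u′ + v + A) ⊎ (u + v′ + A ≡ u′ + v)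
diffMod-≡⇒ A u v u′ v′ v<A v′<A w≡w′
  with diffMod+v≡u⊎u+A A u v v<A | diffMod+v≡u⊎u+A A u′ v′ v′<A
... | inj₁ e | inj₁ e′ = inj₁ (+-exchange w≡w′ e e′)
... | inj₂ e | inj₂ e′ =
  inj₁ (+-cancelʳ-≡ A _ _
    (≡-trans (xy∙z≈xz∙y u v′ A) (≡-trans (+-exchange w≡w′ e e′) (xy∙z≈xz∙y u′ A v))))
... | inj₂ e | inj₁ e′ = inj₂ (inj₂ (≡-trans (xy∙z≈xz∙y u v′ A) (+-exchange w≡w′ e e′)))
... | inj₁ e | inj₂ e′ = inj₂ (inj₁ (≡-trans (+-exchange w≡w′ e e′) (xy∙z≈xz∙y u′ A v)))

pairInjective⇒*≤ : ∀ {p q A} (f : Fin p → Fin q → Fin A) →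
                   (∀ {i j k l} → f i j ≡ f k l → i ≡ k × j ≡ l) → p * q ≤ A
pairInjective⇒*≤ {p} {q} f f-inj = injective⇒≤ {f = uncurry f ∘ remQuot {p} q} remQuot-injective
  where
  remQuot-injective : ∀ {z z′} → uncurry f (remQuot {p} q z) ≡ uncurry f (remQuot {p} q z′) → z ≡ z′
  remQuot-injective {z} {z′} e = begin
    z                                   ≡⟨ combine-remQuot {p} q z ⟨
    uncurry combine (remQuot {p} q z)   ≡⟨ cong (uncurry combine) (×-≡,≡→≡ (f-inj e)) ⟩
    uncurry combine (remQuot {p} q z′)  ≡⟨ combine-remQuot {p} q z′ ⟩
    z′                                  ∎
    where open ≡-Reasoning

-- U ⊆ P and V ⊆ N of equal sum describe the zero-sum subsequence U · (−V), which is proper as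
-- soon as U is.
ProperPartsUnbalanced : List ℕ → List ℕ → Set
ProperPartsUnbalanced P N =
  ∀ {U V} → U ⊆ P → V ⊆ N → 1 ≤ sum U → length U < length P → sum U ≢ sum V

module _ {P N : List ℕ} (P⁺ : Positive P) (N⁺ : Positive N) (sumP≡sumN : sum P ≡ sum N)
         (unbalanced : ProperPartsUnbalanced P N) where

  private
    A : ℕ
    A = sum P

    u v : ℕ → ℕ
    u = prefixSum P
    v = prefixSum N

    v<A : ∀ {j} → j < length N → v j < A
    v<A {j} j<q = subst (v j <_) (sym sumP≡sumN) (prefixSum<sum N⁺ j<q)

    slice-unbalanced : ∀ {k i V} → k < i → i < length P → V ⊆ N → sum (slice k i P) ≢ sum V
    slice-unbalanced {k} {i} k<i i<p V⊆N =
      unbalanced (slice-⊆ k i P) V⊆N (slice-sum-positive P⁺ k<i (<⇒≤ i<p))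
        (≤-<-trans (≤-trans (≤-reflexive (length-slice P k (<⇒≤ i<p))) (m∸n≤m i k)) i<p)

    -- The P-slice [i, k) would have the sum of the N-slice [j, l).
    collision-without-wrap : ∀ {i k j l} → i < k → k < length P → u i + v l ≢ u k + v j
    collision-without-wrap {i} {k} {j} {l} i<k k<p e = compare (≤-total j l)
      where
      α = sum (slice i k P)

      vl≡α+vj : v l ≡ α + v j
      vl≡α+vj = +-cancelˡ-≡ (u i) _ _ (begin
        u i + v l        ≡⟨ e ⟩
        u k + v j        ≡⟨ cong (_+ v j) (prefixSum-slice P (<⇒≤ i<k)) ⟩
        u i + α + v j    ≡⟨ +-assoc (u i) α (v j) ⟩
        u i + (α + v j)  ∎)
        where open ≡-Reasoning

      compare : j ≤ l ⊎ l ≤ j → ⊥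
      compare (inj₁ j≤l) = slice-unbalanced i<k k<p (slice-⊆ j l N) (+-cancelʳ-≡ (v j) _ _ (begin
        α + v j                    ≡⟨ vl≡α+vj ⟨
        v l                        ≡⟨ prefixSum-slice N j≤l ⟩
        v j + sum (slice j l N)    ≡⟨ +-comm (v j) _ ⟩
        sum (slice j l N) + v j    ∎))
        where open ≡-Reasoning
      compare (inj₂ l≤j) = <-irrefl vl≡α+vj
        (≤-<-trans (prefixSum-mono N l≤j) (m<n+m (v j) (slice-sum-positive P⁺ i<k (<⇒≤ k<p))))

    -- The P-slice [k, i) would have the sum of N with its slice [j, l) removed.
    collision-with-wrap-ordered : ∀ {i k j l} → k < i → i < length P → u i + v l ≢ u k + v j + A
    collision-with-wrap-ordered {i} {k} {j} {l} k<i i<p e = compare (≤-total j l)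
      where
      α = sum (slice k i P)

      ui≡uk+α : u i ≡ u k + α
      ui≡uk+α = prefixSum-slice P (<⇒≤ k<i)

      α+vl≡vj+A : α + v l ≡ v j + A
      α+vl≡vj+A = +-cancelˡ-≡ (u k) _ _ (begin
        u k + (α + v l)  ≡⟨ +-assoc (u k) α (v l) ⟨
        u k + α + v l    ≡⟨ cong (_+ v l) ui≡uk+α ⟨
        u i + v l        ≡⟨ e ⟩
        u k + v j + A    ≡⟨ +-assoc (u k) (v j) A ⟩
        u k + (v j + A)  ∎)
        where open ≡-Reasoning

      α<A : α < A
      α<A = ≤-<-trans (≤-trans (m≤n+m α (u k)) (≤-reflexive (sym ui≡uk+α))) (prefixSum<sum P⁺ i<p)

      compare : j ≤ l ⊎ l ≤ j → ⊥
      compare (inj₁ j≤l) =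
        slice-unbalanced k<i i<p (take++drop-⊆ N j≤l) (+-cancelʳ-≡ (v l) _ _ (begin
        α + v l                           ≡⟨ α+vl≡vj+A ⟩
        v j + A                           ≡⟨ cong (_+_ (v j)) A≡vl+rest ⟩
        v j + (v l + sum (drop l N))      ≡⟨ x∙yz≈xz∙y (v j) (v l) _ ⟩
        v j + sum (drop l N) + v l        ≡⟨ cong (_+ v l) (sum-++ (take j N) (drop l N)) ⟨
        sum (take j N ++ drop l N) + v l  ∎))
        where
        open ≡-Reasoning
        A≡vl+rest : A ≡ v l + sum (drop l N)
        A≡vl+rest = ≡-trans sumP≡sumN (sum≡prefixSum+sum-drop N l)
      compare (inj₂ l≤j) = <-irrefl α+vl≡vj+A (begin-strict
        α + v l  <⟨ +-mono-<-≤ α<A (prefixSum-mono N l≤j) ⟩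
        A + v j  ≡⟨ +-comm A (v j) ⟩
        v j + A  ∎)
        where open ≤-Reasoning

    collision-with-wrap : ∀ {i k j l} → i < length P → l < length N → u i + v l ≢ u k + v j + A
    collision-with-wrap {i} {k} {j} {l} i<p l<q e with ≤-<-connex i k
    ... | inj₂ k<i = collision-with-wrap-ordered {i} {k} {j} {l} k<i i<p e
    ... | inj₁ i≤k = <-irrefl e (begin-strict
      u i + v l      <⟨ +-mono-≤-< (prefixSum-mono P i≤k) (v<A l<q) ⟩
      u k + A        ≤⟨ +-monoˡ-≤ A (m≤m+n (u k) (v j)) ⟩
      u k + v j + A  ∎)
      where open ≤-Reasoning

    residue-injective : ∀ {i j k l} → i < length P → k < length P → j < length N → l < length N →
                        diffMod A (u i) (v j) ≡ diffMod A (u k) (v l) → i ≡ k × j ≡ l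
    residue-injective {i} {j} {k} {l} i<p k<p j<q l<q e
      with diffMod-≡⇒ A (u i) (v j) (u k) (v l) (v<A j<q) (v<A l<q) e
    ... | inj₂ (inj₁ wrap) = ⊥-elim (collision-with-wrap {i} {k} {j} {l} i<p l<q wrap)
    ... | inj₂ (inj₂ wrap) = ⊥-elim (collision-with-wrap {k} {i} {l} {j} k<p j<q (sym wrap))
    ... | inj₁ same with <-cmp i k
    ...   | tri< i<k _ _  = ⊥-elim (collision-without-wrap {i} {k} {j} {l} i<k k<p same)
    ...   | tri> _ _ k<i  = ⊥-elim (collision-without-wrap {k} {i} {l} {j} k<i i<p (sym same))
    ...   | tri≈ _ refl _ = refl , prefixSum-injective N⁺ j<q l<q (sym (+-cancelˡ-≡ (u i) _ _ same))

  length*length≤sum : length P * length N ≤ sum P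
  length*length≤sum = pairInjective⇒*≤ residueᶠ residueᶠ-injective
    where
    residueᶠ : Fin (length P) → Fin (length N) → Fin A
    residueᶠ i j =
      fromℕ< (diffMod<A A (u (toℕ i)) (v (toℕ j)) (prefixSum<sum P⁺ (toℕ<n i)) (v<A (toℕ<n j)))

    residueᶠ-injective : ∀ {i j k l} → residueᶠ i j ≡ residueᶠ k l → i ≡ k × j ≡ l
    residueᶠ-injective {i} {j} {k} {l} e
      with residue-injective (toℕ<n i) (toℕ<n k) (toℕ<n j) (toℕ<n l)
             (≡-trans (sym (toℕ-fromℕ< _)) (≡-trans (cong toℕ e) (toℕ-fromℕ< _)))
    ... | i≡k , j≡l = toℕ-injective i≡k , toℕ-injective j≡l

σ-++ : ∀ xs ys → σ (xs ++ ys) ≡ σ xs ℤ.+ σ ys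
σ-++ []       ys = sym (ℤ.+-identityˡ (σ ys))
σ-++ (x ∷ xs) ys = ≡-trans (cong (ℤ._+_ x) (σ-++ xs ys)) (sym (ℤ.+-assoc x (σ xs) (σ ys)))

σ-↭ : σ Preserves _↭_ ⟶ _≡_
σ-↭ p = foldr-commMonoid ℤ+.setoid ℤ+.isCommutativeMonoid (↭⇒↭ₛ p)
  where module ℤ+ = CommutativeMonoid ℤ.+-0-commutativeMonoid

σ-map-+ : ∀ U → σ (map +_ U) ≡ + sum U
σ-map-+ []      = refl
σ-map-+ (x ∷ U) = ≡-trans (cong (ℤ._+_ (+ x)) (σ-map-+ U)) (sym (ℤ.pos-+ x (sum U)))

σ-map-neg : ∀ V → σ (map (-_ ∘ +_) V) ≡ - + sum V
σ-map-neg []      = refl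
σ-map-neg (y ∷ V) = begin
  - + y ℤ.+ σ (map (-_ ∘ +_) V)  ≡⟨ cong (ℤ._+_ (- + y)) (σ-map-neg V) ⟩
  - + y ℤ.+ - + sum V            ≡⟨ ℤ.neg-distrib-+ (+ y) (+ sum V) ⟨
  - (+ y ℤ.+ + sum V)            ≡⟨ cong -_ (ℤ.pos-+ y (sum V)) ⟨
  - + (y + sum V)                ∎
  where open ≡-Reasoning

signed : List ℕ → List ℕ → List ℤ
signed U V = map +_ U ++ map (-_ ∘ +_) V

σ-signed : ∀ U V → σ (signed U V) ≡ + sum U ℤ.- + sum V
σ-signed U V = ≡-trans (σ-++ (map +_ U) _) (cong₂ ℤ._+_ (σ-map-+ U) (σ-map-neg V))

length-signed : ∀ U V → length (signed U V) ≡ length U + length V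
length-signed U V =
  ≡-trans (length-++ (map +_ U)) (cong₂ _+_ (length-map +_ U) (length-map (-_ ∘ +_) V))

⊆-resp-↭ : ∀ {A : Set} {xs ys zs : List A} → xs ⊆ ys → ys ↭ zs →
           Σ (List A) λ ws → ws ⊆ zs × ws ↭ xs
⊆-resp-↭ {xs = xs} τ refl = xs , τ , refl
⊆-resp-↭ (x ∷ʳ τ) (prep x p) with ⊆-resp-↭ τ p
... | ws , σ , q = ws , x ∷ʳ σ , q
⊆-resp-↭ (refl ∷ τ) (prep x p) with ⊆-resp-↭ τ p
... | ws , σ , q = x ∷ ws , refl ∷ σ , prep x q
⊆-resp-↭ (x ∷ʳ (y ∷ʳ τ)) (swap x y p) with ⊆-resp-↭ τ p
... | ws , σ , q = ws , y ∷ʳ (x ∷ʳ σ) , q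
⊆-resp-↭ (x ∷ʳ (refl ∷ τ)) (swap x y p) with ⊆-resp-↭ τ p
... | ws , σ , q = y ∷ ws , refl ∷ (x ∷ʳ σ) , prep y q
⊆-resp-↭ (refl ∷ (y ∷ʳ τ)) (swap x y p) with ⊆-resp-↭ τ p
... | ws , σ , q = x ∷ ws , y ∷ʳ (refl ∷ σ) , prep x q
⊆-resp-↭ (refl ∷ (refl ∷ τ)) (swap x y p) with ⊆-resp-↭ τ p
... | ws , σ , q = y ∷ x ∷ ws , refl ∷ (refl ∷ σ) , swap y x q
⊆-resp-↭ τ (trans p p′) with ⊆-resp-↭ τ p
... | ws , σ , q with ⊆-resp-↭ σ p′
...   | ws′ , σ′ , q′ = ws′ , σ′ , trans q′ q

module _ {S : List ℤ} {P N : List ℕ} (S-minimal : MinimalZeroSum S) (S↭PN : S ↭ signed P N) where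

  private
    σS≡0 : σ S ≡ + 0
    σS≡0 = proj₁ (proj₂ S-minimal)

  minimalZeroSum⇒sum≡sum : sum P ≡ sum N
  minimalZeroSum⇒sum≡sum =
    ℤ.+-injective (ℤ.i-j≡0⇒i≡j _ _ (≡-trans (sym (σ-signed P N)) (≡-trans (sym (σ-↭ S↭PN)) σS≡0)))

  minimalZeroSum⇒properPartsUnbalanced : ProperPartsUnbalanced P N
  minimalZeroSum⇒properPartsUnbalanced {[]}    _ _ ()
  minimalZeroSum⇒properPartsUnbalanced {x ∷ U} {V} U⊆P V⊆N _ |U|<|P| ΣU≡ΣV
    with ⊆-resp-↭ (++⁺ (map⁺ +_ U⊆P) (map⁺ (-_ ∘ +_) V⊆N)) (↭-sym S↭PN)
  ... | T , T⊆S , T↭UV = proj₂ (proj₂ S-minimal) T T⊆S T≢[] |T|<|S| σT≡0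
    where
    T≢[] : T ≢ []
    T≢[] refl with ↭-length T↭UV
    ... | ()

    |T|<|S| : length T < length S
    |T|<|S| = begin-strict
      length T                         ≡⟨ ↭-length T↭UV ⟩
      length (signed (x ∷ U) V)        ≡⟨ length-signed (x ∷ U) V ⟩
      length (x ∷ U) + length V        <⟨ +-mono-<-≤ |U|<|P| (length-mono-≤ V⊆N) ⟩
      length P + length N              ≡⟨ length-signed P N ⟨
      length (signed P N)              ≡⟨ ↭-length S↭PN ⟨
      length S                         ∎
      where open ≤-Reasoning

    σT≡0 : σ T ≡ + 0
    σT≡0 = begin
      σ T                                ≡⟨ σ-↭ T↭UV ⟩
      σ (signed (x ∷ U) V)               ≡⟨ σ-signed (x ∷ U) V ⟩
      + sum (x ∷ U) ℤ.- + sum V          ≡⟨ cong (λ s → + sum (x ∷ U) ℤ.- + s) ΣU≡ΣV ⟨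
      + sum (x ∷ U) ℤ.- + sum (x ∷ U)    ≡⟨ ℤ.+-inverseʳ (+ sum (x ∷ U)) ⟩
      + 0                                ∎
      where open ≡-Reasoning

-- `block` is `block′` at ℤ, definitionally.
block′ : {A : Set} (n : ℕ) → (Fin n → A) → (Fin n → ℕ) → List A
block′ n a x = concat (tabulate (λ i → replicate (x i) (a i)))

map-block′ : ∀ {A B : Set} (f : A → B) n (a : Fin n → A) x → map f (block′ n a x) ≡ block′ n (f ∘ a) x
map-block′ f n a x = begin
  map f (concat (tabulate r))                          ≡⟨ concat-map (tabulate r) ⟨
  concat (map (map f) (tabulate r))                    ≡⟨ cong concat (map-tabulate r (map f)) ⟩
  concat (tabulate (map f ∘ r))                        ≡⟨ cong concat (tabulate-cong map-r) ⟩
  concat (tabulate (λ i → replicate (x i) (f (a i))))  ∎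
  where
  open ≡-Reasoning
  r = λ i → replicate (x i) (a i)
  map-r = λ i → map-replicate f (x i) (a i)

length-block′ : ∀ {A : Set} n (a : Fin n → A) x → length (block′ n a x) ≡ Σℕ n x
length-block′ zero    a x = refl
length-block′ (suc n) a x = ≡-trans (length-++ (replicate (x Fin.zero) (a Fin.zero)))
  (cong₂ _+_ (length-replicate (x Fin.zero)) (length-block′ n (a ∘ Fin.suc) (x ∘ Fin.suc)))

sum-replicate : ∀ c v → sum (replicate c v) ≡ c * v
sum-replicate zero    v = refl
sum-replicate (suc c) v = cong (_+_ v) (sum-replicate c v)

sum-block′ : ∀ n (a x : Fin n → ℕ) → sum (block′ n a x) ≡ Σℕ n (λ i → a i * x i)
sum-block′ zero    a x = refl
sum-block′ (suc n) a x = ≡-trans (sum-++ (replicate (x Fin.zero) (a Fin.zero)) _)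
  (cong₂ _+_ (≡-trans (sum-replicate (x Fin.zero) (a Fin.zero)) (*-comm (x Fin.zero) (a Fin.zero)))
             (sum-block′ n (a ∘ Fin.suc) (x ∘ Fin.suc)))

block′⁺ : ∀ {A : Set} {Q : A → Set} n {a : Fin n → A} x → (∀ i → Q (a i)) → All Q (block′ n a x)
block′⁺ n x Qa = concat⁺ (tabulate⁺ (λ i → replicate⁺ (x i) (Qa i)))

*≤⇒≤⌊/⌋ : ∀ {p q s} → p * q ≤ s → (q ≡ 0 → p ≡ 0) → p ≤ ⌊ s / q ⌋
*≤⇒≤⌊/⌋ {q = zero}  _     p≡0 = ≤-reflexive (p≡0 refl)
*≤⇒≤⌊/⌋ {p} {suc q} {s} p*q≤s _ =
  subst (_≤ s / suc q) (m*n/n≡m p (suc q)) (/-monoˡ-≤ (suc q) p*q≤s)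

length≡0-balanced : ∀ {P N} → Positive P → sum P ≡ sum N → length N ≡ 0 → length P ≡ 0
length≡0-balanced {N = []} P⁺ ΣP≡ΣN _ = n≤0⇒n≡0 (≤-trans (length≤sum P⁺) (≤-reflexive ΣP≡ΣN))

minimalZeroSum-length≤⌊/⌋ : ∀ {S P N} → MinimalZeroSum S → S ↭ signed P N →
                            Positive P → Positive N →
                            length P ≤ ⌊ sum N / length N ⌋ × length N ≤ ⌊ sum P / length P ⌋
minimalZeroSum-length≤⌊/⌋ {P = P} {N} S-minimal S↭PN P⁺ N⁺ =
    *≤⇒≤⌊/⌋ (subst (length P * length N ≤_) ΣP≡ΣN |P||N|≤ΣP) (length≡0-balanced {N = N} P⁺ ΣP≡ΣN)
  , *≤⇒≤⌊/⌋ (subst (_≤ sum P) (*-comm (length P) (length N)) |P||N|≤ΣP)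
            (length≡0-balanced {N = P} N⁺ (sym ΣP≡ΣN))
  where
  ΣP≡ΣN : sum P ≡ sum N
  ΣP≡ΣN = minimalZeroSum⇒sum≡sum {P = P} {N} S-minimal S↭PN

  |P||N|≤ΣP : length P * length N ≤ sum P
  |P||N|≤ΣP =
    length*length≤sum P⁺ N⁺ ΣP≡ΣN (minimalZeroSum⇒properPartsUnbalanced {P = P} {N} S-minimal S↭PN)

theorem1p3 : (S : List ℤ) → MinimalZeroSum S → 1 < length S →
    (n m : ℕ) (a x : Fin n → ℕ) (b y : Fin m → ℕ) →
    (∀ i → 1 ≤ a i) → (∀ i → 1 ≤ x i) → (∀ i j → i ≤ᶠ j → a i ≤ a j) →
    (∀ j → 1 ≤ b j) → (∀ j → 1 ≤ y j) → (∀ i j → i ≤ᶠ j → b i ≤ b j) →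
    S ↭ (block n (λ i → + (a i)) x ++ block m (λ j → - (+ (b j))) y) →
    (Σℕ n x ≤ ⌊ Σℕ m (λ j → b j * y j) / Σℕ m y ⌋)
      × (Σℕ m y ≤ ⌊ Σℕ n (λ i → a i * x i) / Σℕ n x ⌋)
theorem1p3 S S-minimal _ n m a x b y a⁺ _ _ b⁺ _ _ S↭
  rewrite sym (length-block′ n a x) | sym (length-block′ m b y)
        | sym (sum-block′ n a x)    | sym (sum-block′ m b y)
  = minimalZeroSum-length≤⌊/⌋ S-minimal S↭PN (block′⁺ n x a⁺) (block′⁺ m y b⁺)
  where
  S↭PN : S ↭ signed (block′ n a x) (block′ m b y)
  S↭PN = subst (S ↭_) (sym (cong₂ _++_ (map-block′ +_ n a x) (map-block′ (-_ ∘ +_) m b y))) S↭
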